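{- Let $G$ be a finite simple graph and let $S,T\in\Psi(G)$. Then $T\setminus N[S]\in\Psi(G-N[S])$ and $S\setminus N[T]\in\Psi(G-N[T])$.
   Context: For a graph $G$ and $X\subseteq V(G)$, $N(X)$ is the set of vertices adjacent to some vertex of $X$ and $N[X]=X\cup N(X)$; $G[X]$ is the induced subgraph on $X$, and $G-X$ denotes the induced subgraph $G[V(G)\setminus X]$. A set $S\subseteq V(G)$ is a local maximum independent set of $G$ if $S$ is a maximum independent set of $G[N[S]]$; $\Psi(G)$ denotes the family of all local maximum independent sets of $G$ (and similarly $\Psi(H)$ for any graph $H$, with neighborhoods taken in $H$). -}

module Defs where

open import Data.Nat using (ℕ; zero; suc; _≤_)
open import Data.Bool using (Bool; true; false; _∧_; _∨_)
open import Data.Fin using (Fin; zero; suc)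
open import Data.Fin.Subset using (Subset; _∈_; _⊆_; ∣_∣; _∪_; _∩_; ⊤)
open import Data.Vec using (tabulate; lookup)
open import Data.Product using (_×_)
open import Relation.Binary.PropositionalEquality using (_≡_)

record Graph (n : ℕ) : Set where
  field
    adj   : Fin n → Fin n → Bool
    sym   : ∀ u v → adj u v ≡ adj v u
    irrefl : ∀ v → adj v v ≡ false
open Graph public

anyFin : ∀ {n} → (Fin n → Bool) → Bool
anyFin {zero}  f = false
anyFin {suc n} f = f zero ∨ anyFin (λ i → f (suc i))

-- Induced subgraphs G[W] are represented by their vertex set W ⊆ V(G).
-- Open neighbourhood of X taken in G[W]: vertices of W adjacent to some vertex of X.
Nbhd : ∀ {n} → Graph n → Subset n → Subset n → Subset n
Nbhd G W X = tabulate (λ v → lookup W v ∧ anyFin (λ x → lookup X x ∧ adj G x v))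

CNbhd : ∀ {n} → Graph n → Subset n → Subset n → Subset n
CNbhd G W X = X ∪ Nbhd G W X

N[_,_] : ∀ {n} → Graph n → Subset n → Subset n
N[ G , X ] = CNbhd G ⊤ X

-- I is independent (no edges of G between members of I; for I ⊆ W this
-- is independence in G[W] since G[W] is induced).
Independent : ∀ {n} → Graph n → Subset n → Set
Independent G I = ∀ u v → u ∈ I → v ∈ I → adj G u v ≡ false

MaximumIndependentIn : ∀ {n} → Graph n → Subset n → Subset n → Set
MaximumIndependentIn G U S =
  S ⊆ U × Independent G S × (∀ I → I ⊆ U → Independent G I → ∣ I ∣ ≤ ∣ S ∣)

-- S ∈ Ψ(G[W]): S ⊆ W and S is a maximum independent set of G[N[S]],
-- the neighbourhood taken in G[W].
LocalMaxIndep : ∀ {n} → Graph n → Subset n → Subset n → Set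
LocalMaxIndep G W S = S ⊆ W × MaximumIndependentIn G (CNbhd G W S) S

Ψ : ∀ {n} → Graph n → Subset n → Set
Ψ G S = LocalMaxIndep G ⊤ S

{-# OPTIONS --safe #-}
-- If S ∈ Ψ(G) and A ⊆ N[S] is independent, then A ∪ (S ∖ N[A]) is independent inside
-- N[S], so |A| ≤ |S ∩ N[A]|. Take A = T ∩ N[S]. An independent set I in the closed
-- neighbourhood of T ∖ N[S] within G − N[S] lies in N[T] and has no neighbour in S, so
-- I ∪ (S ∩ N[A]) is independent inside N[T] and
-- |I| + |A| ≤ |I| + |S ∩ N[A]| ≤ |T| = |T ∖ N[S]| + |A|.
module Submission where

open import Defs
open import Data.Nat using (ℕ; suc; _+_; _≤_)
open import Data.Nat.Properties using (+-suc; +-cancelˡ-≤; +-cancelʳ-≤; +-monoʳ-≤; module ≤-Reasoning)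
open import Data.Bool using (Bool; true; false; _∧_)
open import Data.Bool.Properties using (∧-conicalˡ; ∧-conicalʳ; ¬-not)
open import Data.Fin using (Fin; zero; suc)
open import Data.Fin.Subset using (Subset; _─_; ∁; _∈_; _∉_; _⊆_; ∣_∣; _∪_; _∩_; ⊤; inside; outside)
open import Data.Fin.Subset.Properties
  using (drop-there; ∈⊤; ⊆⊤; ⊆-refl; ⊆-trans; x∈∁p⇒x∉p; p⊆q⇒∁p⊇∁q; x∈p∪q⁻; p⊆p∪q; q⊆p∪q; p∩q⊆p; p∩q⊆q; p─q⊆p)
open import Data.Vec using (_∷_; []; here; there; lookup)
open import Data.Vec.Properties using (lookup∘tabulate; []=⇒lookup; lookup⇒[]=)
open import Data.Product using (_×_; _,_; proj₁; ∃)
open import Data.Sum using (inj₁; inj₂; [_,_])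
open import Function using (_∘_)
open import Relation.Nullary using (contradiction)
open import Relation.Binary.PropositionalEquality as ≡ using (_≡_; refl; trans; cong)

private
  variable
    n : ℕ
    P Q R : Subset n

∪-least : P ⊆ R → Q ⊆ R → P ∪ Q ⊆ R
∪-least {P = P} {Q = Q} P⊆R Q⊆R x∈P∪Q = [ P⊆R , Q⊆R ] (x∈p∪q⁻ P Q x∈P∪Q)

p─q⊆∁q : ∀ (p q : Subset n) → p ─ q ⊆ ∁ q
p─q⊆∁q (inside ∷ p) (outside ∷ q) here        = here
p─q⊆∁q (_      ∷ p) (inside  ∷ q) (there x∈p) = there (p─q⊆∁q p q x∈p)
p─q⊆∁q (_      ∷ p) (outside ∷ q) (there x∈p) = there (p─q⊆∁q p q x∈p)

∣p∣≡∣p─q∣+∣p∩q∣ : ∀ (p q : Subset n) → ∣ p ∣ ≡ ∣ p ─ q ∣ + ∣ p ∩ q ∣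
∣p∣≡∣p─q∣+∣p∩q∣ []            []            = refl
∣p∣≡∣p─q∣+∣p∩q∣ (inside  ∷ p) (inside  ∷ q) =
  trans (cong suc (∣p∣≡∣p─q∣+∣p∩q∣ p q)) (≡.sym (+-suc ∣ p ─ q ∣ ∣ p ∩ q ∣))
∣p∣≡∣p─q∣+∣p∩q∣ (inside  ∷ p) (outside ∷ q) = cong suc (∣p∣≡∣p─q∣+∣p∩q∣ p q)
∣p∣≡∣p─q∣+∣p∩q∣ (outside ∷ p) (inside  ∷ q) = ∣p∣≡∣p─q∣+∣p∩q∣ p q
∣p∣≡∣p─q∣+∣p∩q∣ (outside ∷ p) (outside ∷ q) = ∣p∣≡∣p─q∣+∣p∩q∣ p q

∣p∪q∣≡∣p∣+∣q∣ : ∀ (p q : Subset n) → p ⊆ ∁ q → ∣ p ∪ q ∣ ≡ ∣ p ∣ + ∣ q ∣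
∣p∪q∣≡∣p∣+∣q∣ []            []            _     = refl
∣p∪q∣≡∣p∣+∣q∣ (inside  ∷ p) (inside  ∷ q) p⊆∁q = contradiction here (x∈∁p⇒x∉p (p⊆∁q here))
∣p∪q∣≡∣p∣+∣q∣ (inside  ∷ p) (outside ∷ q) p⊆∁q =
  cong suc (∣p∪q∣≡∣p∣+∣q∣ p q (drop-there ∘ p⊆∁q ∘ there))
∣p∪q∣≡∣p∣+∣q∣ (outside ∷ p) (inside  ∷ q) p⊆∁q =
  trans (cong suc (∣p∪q∣≡∣p∣+∣q∣ p q (drop-there ∘ p⊆∁q ∘ there))) (≡.sym (+-suc ∣ p ∣ ∣ q ∣))
∣p∪q∣≡∣p∣+∣q∣ (outside ∷ p) (outside ∷ q) p⊆∁q = ∣p∪q∣≡∣p∣+∣q∣ p q (drop-there ∘ p⊆∁q ∘ there)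

anyFin⁻ : (f : Fin n → Bool) → anyFin f ≡ true → ∃ λ i → f i ≡ true
anyFin⁻ {suc n} f any-f with f zero in f0
... | true  = zero , f0
... | false with anyFin⁻ (f ∘ suc) any-f
...   | i , fi = suc i , fi

anyFin⁺ : (f : Fin n → Bool) (i : Fin n) → f i ≡ true → anyFin f ≡ true
anyFin⁺ f zero    fi rewrite fi = refl
anyFin⁺ f (suc i) fi with f zero
... | true  = refl
... | false = anyFin⁺ (f ∘ suc) i fi

module _ (G : Graph n) where

  private
    variable
      v x : Fin n
      W W′ X X′ S T I B U : Subset n

  ∈Nbhd⁻ : ∀ W X → v ∈ Nbhd G W X → v ∈ W × ∃ λ x → x ∈ X × adj G x v ≡ true
  ∈Nbhd⁻ {v} W X v∈N =
    lookup⇒[]= v W (∧-conicalˡ _ _ holds) , adjacent-in-X (anyFin⁻ _ (∧-conicalʳ _ _ holds))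
    where
    holds : lookup W v ∧ anyFin (λ x → lookup X x ∧ adj G x v) ≡ true
    holds = trans (≡.sym (lookup∘tabulate _ v)) ([]=⇒lookup v∈N)
    adjacent-in-X : ∃ (λ x → lookup X x ∧ adj G x v ≡ true) → ∃ λ x → x ∈ X × adj G x v ≡ true
    adjacent-in-X (x , x∈X∧x~v) = x , lookup⇒[]= x X (∧-conicalˡ _ _ x∈X∧x~v) , ∧-conicalʳ _ _ x∈X∧x~v

  ∈Nbhd⁺ : v ∈ W → x ∈ X → adj G x v ≡ true → v ∈ Nbhd G W X
  ∈Nbhd⁺ {v} {W} {x} {X} v∈W x∈X x~v = lookup⇒[]= v _ (trans (lookup∘tabulate _ v) holds)
    where
    holds : lookup W v ∧ anyFin (λ y → lookup X y ∧ adj G y v) ≡ true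
    holds rewrite []=⇒lookup v∈W = anyFin⁺ _ x (trans (cong (_∧ adj G x v) ([]=⇒lookup x∈X)) x~v)

  Nbhd⊆ : ∀ W X → Nbhd G W X ⊆ W
  Nbhd⊆ W X v∈N = proj₁ (∈Nbhd⁻ W X v∈N)

  CNbhd⊆ : X ⊆ W → CNbhd G W X ⊆ W
  CNbhd⊆ {X} {W} X⊆W = ∪-least X⊆W (Nbhd⊆ W X)

  CNbhd-mono : W ⊆ W′ → X ⊆ X′ → CNbhd G W X ⊆ CNbhd G W′ X′
  CNbhd-mono {W} {W′} {X} {X′} W⊆W′ X⊆X′ =
    ∪-least (⊆-trans X⊆X′ (p⊆p∪q _)) (⊆-trans Nbhd-mono (q⊆p∪q X′ _))
    where
    Nbhd-mono : Nbhd G W X ⊆ Nbhd G W′ X′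
    Nbhd-mono v∈N with ∈Nbhd⁻ W X v∈N
    ... | v∈W , x , x∈X , x~v = ∈Nbhd⁺ (W⊆W′ v∈W) (X⊆X′ x∈X) x~v

  N[]-mono : X ⊆ X′ → N[ G , X ] ⊆ N[ G , X′ ]
  N[]-mono = CNbhd-mono {W = ⊤} ⊆-refl

  ∉N[]⇒nonadjacent : v ∉ N[ G , X ] → x ∈ X → adj G x v ≡ false
  ∉N[]⇒nonadjacent {X = X} v∉NX x∈X = ¬-not λ x~v → v∉NX (q⊆p∪q X _ (∈Nbhd⁺ ∈⊤ x∈X x~v))

  independent-⊆ : I ⊆ B → Independent G B → Independent G I
  independent-⊆ I⊆B indB u v u∈I v∈I = indB u v (I⊆B u∈I) (I⊆B v∈I)

  independent-∪ : Independent G I → Independent G B → I ⊆ ∁ N[ G , B ] → Independent G (I ∪ B)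
  independent-∪ {I} {B} indI indB I⊆∁NB u v u∈ v∈ with x∈p∪q⁻ I B u∈ | x∈p∪q⁻ I B v∈
  ... | inj₁ u∈I | inj₁ v∈I = indI u v u∈I v∈I
  ... | inj₁ u∈I | inj₂ v∈B = trans (sym G u v) (∉N[]⇒nonadjacent (x∈∁p⇒x∉p (I⊆∁NB u∈I)) v∈B)
  ... | inj₂ u∈B | inj₁ v∈I = ∉N[]⇒nonadjacent (x∈∁p⇒x∉p (I⊆∁NB v∈I)) u∈B
  ... | inj₂ u∈B | inj₂ v∈B = indB u v u∈B v∈B

  separated-∪-≤-maximum : MaximumIndependentIn G U T → I ⊆ U → B ⊆ U →
    Independent G I → Independent G B → I ⊆ ∁ N[ G , B ] → ∣ I ∣ + ∣ B ∣ ≤ ∣ T ∣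
  separated-∪-≤-maximum {T = T} {I} {B} (_ , _ , maximum) I⊆U B⊆U indI indB I⊆∁NB = begin
    ∣ I ∣ + ∣ B ∣  ≡⟨ ∣p∪q∣≡∣p∣+∣q∣ I B (⊆-trans I⊆∁NB (p⊆q⇒∁p⊇∁q (p⊆p∪q _))) ⟨
    ∣ I ∪ B ∣      ≤⟨ maximum (I ∪ B) (∪-least I⊆U B⊆U) (independent-∪ indI indB I⊆∁NB) ⟩
    ∣ T ∣          ∎
    where open ≤-Reasoning

  Ψ⇒∣A∣≤∣S∩N[A]∣ : ∀ {A} → Ψ G S → Independent G A → A ⊆ N[ G , S ] → ∣ A ∣ ≤ ∣ S ∩ N[ G , A ] ∣
  Ψ⇒∣A∣≤∣S∩N[A]∣ {S} {A} (_ , maxS@(_ , indS , _)) indA A⊆NS = +-cancelˡ-≤ ∣ S ─ NA ∣ _ _ (begin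
    ∣ S ─ NA ∣ + ∣ A ∣       ≤⟨ separated-∪-≤-maximum maxS
                                  (⊆-trans (p─q⊆p S NA) (p⊆p∪q _)) A⊆NS
                                  (independent-⊆ (p─q⊆p S NA) indS) indA (p─q⊆∁q S NA) ⟩
    ∣ S ∣                    ≡⟨ ∣p∣≡∣p─q∣+∣p∩q∣ S NA ⟩
    ∣ S ─ NA ∣ + ∣ S ∩ NA ∣  ∎)
    where
    open ≤-Reasoning
    NA = N[ G , A ]

  Ψ⇒T─N[S]∈Ψ[G─N[S]] : Ψ G S → Ψ G T → LocalMaxIndep G (∁ N[ G , S ]) (T ─ N[ G , S ])
  Ψ⇒T─N[S]∈Ψ[G─N[S]] {S} {T} ψS@(_ , _ , indS , _) (_ , maxT@(_ , indT , _)) =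
    T′⊆W , p⊆p∪q _ , independent-⊆ (p─q⊆p T NS) indT , maximum
    where
    open ≤-Reasoning
    NS = N[ G , S ]
    T′ = T ─ NS
    A  = T ∩ NS
    NA = N[ G , A ]

    T′⊆W : T′ ⊆ ∁ NS
    T′⊆W = p─q⊆∁q T NS

    ∣A∣≤∣S∩NA∣ : ∣ A ∣ ≤ ∣ S ∩ NA ∣
    ∣A∣≤∣S∩NA∣ = Ψ⇒∣A∣≤∣S∩N[A]∣ ψS (independent-⊆ (p∩q⊆p T NS) indT) (p∩q⊆q T NS)

    maximum : ∀ I → I ⊆ CNbhd G (∁ NS) T′ → Independent G I → ∣ I ∣ ≤ ∣ T′ ∣
    maximum I I⊆N[T′] indI = +-cancelʳ-≤ ∣ A ∣ _ _ (begin
      ∣ I ∣ + ∣ A ∣       ≤⟨ +-monoʳ-≤ ∣ I ∣ ∣A∣≤∣S∩NA∣ ⟩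
      ∣ I ∣ + ∣ S ∩ NA ∣  ≤⟨ separated-∪-≤-maximum maxT
                               (⊆-trans I⊆N[T′] (CNbhd-mono {W = ∁ NS} ⊆⊤ (p─q⊆p T NS)))
                               (⊆-trans (p∩q⊆q S NA) (N[]-mono (p∩q⊆p T NS)))
                               indI (independent-⊆ (p∩q⊆p S NA) indS)
                               (⊆-trans (⊆-trans I⊆N[T′] (CNbhd⊆ T′⊆W))
                                        (p⊆q⇒∁p⊇∁q (N[]-mono (p∩q⊆p S NA)))) ⟩
      ∣ T ∣               ≡⟨ ∣p∣≡∣p─q∣+∣p∩q∣ T NS ⟩
      ∣ T′ ∣ + ∣ A ∣      ∎)

lemma3p3 : ∀ {n} (G : Graph n) (S T : Subset n) → Ψ G S → Ψ G T →
    LocalMaxIndep G (∁ N[ G , S ]) (T ─ N[ G , S ])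
      × LocalMaxIndep G (∁ N[ G , T ]) (S ─ N[ G , T ])
lemma3p3 G S T ψS ψT = Ψ⇒T─N[S]∈Ψ[G─N[S]] G ψS ψT , Ψ⇒T─N[S]∈Ψ[G─N[S]] G ψT ψS
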